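{- Let $\mathcal{G}$ be a partial Sherk plane and $k$ a positive integer. Then $\mathcal{G}_k$ is a partial Sherk plane, and it is finite if $\mathcal{G}$ is finite. Further, if $k$ is even, then $\mathcal{G}_k^*$ is a partial Sherk plane, and it is finite if $\mathcal{G}$ is finite.
   Context: A partial Sherk plane is a structure of points, lines, an incidence relation, and a binary relation $\perp$ on lines satisfying: (A*) two distinct points lie on at most one line; (B1) $\ell\perp m$ implies $m\perp\ell$; (B2) perpendicular lines intersect in at least one point; (B3) for any point $P$ and line $\ell$ there is at least one line through $P$ perpendicular to $\ell$; (B4) for any line $\ell$ and point $P$ on $\ell$ there is a unique line through $P$ perpendicular to $\ell$; (B5) there exist lines $x,y,z$ with $x\perp y$, $x\not\perp z$, $y\not\perp z$, and $x,y,z$ not all through a common point. Finite means finitely many points. Construction of $\mathcal{G}_k$: for each line $\ell$ of $\mathcal{G}$ and each $i\in\{1,\dots,k\}$ add a new point $P_{\ell,i}$ incident with $\ell$ and with no other line of $\mathcal{G}$; add new lines $g_1,\dots,g_k$, where $g_i$ is incident exactly with the points $P_{\ell,i}$ ($\ell$ ranging over lines of $\mathcal{G}$); extend $\perp$ so that each $g_i$ is perpendicular to every line of $\mathcal{G}$ and vice versa, and $g_i\not\perp g_j$ for all $i,j$ (perpendicularity among lines of $\mathcal{G}$ is unchanged). Construction of $\mathcal{G}_k^*$ for $k$ even: add to $\mathcal{G}_k$ a new point $Q$ incident with $g_1,\dots,g_k$ and no other line, and modify perpendicularity so that $g_i\perp g_{k-i+1}$ for $1\le i\le k$ (all other perpendicularities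 as in $\mathcal{G}_k$). -}

module Defs where

open import Level using (0ℓ)
open import Data.Nat using (ℕ)
open import Data.Fin using (Fin; opposite)
open import Data.Unit using (⊤; tt)
open import Data.Empty using (⊥)
open import Data.Sum using (_⊎_; inj₁; inj₂)
open import Data.Product using (Σ; ∃; _×_; _,_)
open import Relation.Nullary using (¬_)
open import Relation.Binary.PropositionalEquality using (_≡_; _≢_)
open import Function.Bundles using (_↔_)

record Geometry : Set₁ where
  field
    Point : Set
    Line  : Set
    _I_   : Point → Line → Set
    _⟂_   : Line → Line → Set

record IsPartialSherkPlane (G : Geometry) : Set where
  open Geometry G
  field
    A*  : ∀ (P Q : Point) (ℓ m : Line) → P ≢ Q →
          P I ℓ → Q I ℓ → P I m → Q I m → ℓ ≡ m
    B1  : ∀ (ℓ m : Line) → ℓ ⟂ m → m ⟂ ℓ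
    B2  : ∀ (ℓ m : Line) → ℓ ⟂ m → Σ Point λ P → P I ℓ × P I m
    B3  : ∀ (P : Point) (ℓ : Line) → Σ Line λ m → P I m × m ⟂ ℓ
    B4  : ∀ (ℓ : Line) (P : Point) → P I ℓ →
          Σ Line λ m → (P I m × m ⟂ ℓ) ×
            (∀ (m' : Line) → P I m' → m' ⟂ ℓ → m' ≡ m)
    B5  : Σ Line λ x → Σ Line λ y → Σ Line λ z →
          x ⟂ y × ¬ (x ⟂ z) × ¬ (y ⟂ z) ×
          ¬ (Σ Point λ P → P I x × P I y × P I z)

Finite : Geometry → Set
Finite G = ∃ λ (n : ℕ) → Geometry.Point G ↔ Fin n

-- The construction 𝒢_k.  Points: old points (inj₁) and new points P_{ℓ,i}
-- (inj₂ (ℓ , i)); lines: old lines (inj₁) and g_i (inj₂ i).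
-- The index i ∈ {1,…,k} is represented by Fin k (0-based).
module _ (G : Geometry) (k : ℕ) where
  open Geometry G

  GkI : Point ⊎ (Line × Fin k) → Line ⊎ Fin k → Set
  GkI (inj₁ P)       (inj₁ m) = P I m
  GkI (inj₁ P)       (inj₂ j) = ⊥
  GkI (inj₂ (ℓ , i)) (inj₁ m) = ℓ ≡ m
  GkI (inj₂ (ℓ , i)) (inj₂ j) = i ≡ j

  Gk⊥ : Line ⊎ Fin k → Line ⊎ Fin k → Set
  Gk⊥ (inj₁ ℓ) (inj₁ m) = ℓ ⟂ m
  Gk⊥ (inj₁ ℓ) (inj₂ j) = ⊤
  Gk⊥ (inj₂ i) (inj₁ m) = ⊤
  Gk⊥ (inj₂ i) (inj₂ j) = ⊥

  Gk : Geometry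
  Gk = record
    { Point = Point ⊎ (Line × Fin k)
    ; Line  = Line ⊎ Fin k
    ; _I_   = GkI
    ; _⟂_   = Gk⊥
    }

  -- The construction 𝒢_k^* (meaningful for k even): add the point Q
  -- (inj₂ tt) lying on all g_i and on no old line, and set g_i ⟂ g_j iff
  -- j = k - i + 1 (1-based), i.e. j = opposite i (0-based: j = k - 1 - i).
  Gk*I : (Point ⊎ (Line × Fin k)) ⊎ ⊤ → Line ⊎ Fin k → Set
  Gk*I (inj₁ X)  ℓ        = GkI X ℓ
  Gk*I (inj₂ tt) (inj₁ m) = ⊥
  Gk*I (inj₂ tt) (inj₂ j) = ⊤

  Gk*⊥ : Line ⊎ Fin k → Line ⊎ Fin k → Set
  Gk*⊥ (inj₂ i) (inj₂ j) = j ≡ opposite i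
  Gk*⊥ (inj₁ ℓ) m        = Gk⊥ (inj₁ ℓ) m
  Gk*⊥ (inj₂ i) (inj₁ m) = Gk⊥ (inj₂ i) (inj₁ m)

  Gk* : Geometry
  Gk* = record
    { Point = (Point ⊎ (Line × Fin k)) ⊎ ⊤
    ; Line  = Line ⊎ Fin k
    ; _I_   = Gk*I
    ; _⟂_   = Gk*⊥
    }

module Submission where

-- The
-- only facts about 𝒢 beyond its axioms that the verification needs are that
-- perpendicularity is irreflexive (a new point P_{ℓ,i} lies on a single old
-- line, so ℓ ⟂ ℓ would give it two perpendiculars to ℓ) and that every point
-- lies on some line.  For 𝒢_k^* one further needs that i ↦ k - i + 1 has no
-- fixed point when k is even, so that g_i ⊥̸ g_i.
--
-- Finiteness: the points of 𝒢_k are the old points together with Lines × Fin k,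
-- so it suffices that a finite partial Sherk plane has finitely many lines.
-- Classically every line is determined by a pair of its points, or, if it has
-- only one point P, as the perpendicular at P to the line joining P with any
-- other point.  Lines are therefore the image of the finite type
-- Point × Point × Bool, and an image of a finite type with decidable equality
-- is finite.

open import Defs
open import Level using (0ℓ)
open import Axiom.ExcludedMiddle using (ExcludedMiddle)
open import Data.Nat using (ℕ; zero; suc; _+_; _*_; _∸_; _≤_)
open import Data.Nat.Properties using (+-suc; +-identityʳ; *-comm; m∸n+n≡m; even≢odd)
open import Data.Nat.Divisibility using (_∣_; divides)
open import Data.Fin using (Fin; zero; suc; toℕ; opposite; fromℕ<)
open import Data.Fin.Properties
  using (¬Fin0; any?; toℕ<n; opposite-prop; opposite-involutive; +↔⊎; *↔×; 1↔⊤; 2↔Bool)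
open import Data.Bool using (Bool; true; false)
open import Data.Bool.Properties using (T-irrelevant)
open import Data.Unit using (⊤; tt)
open import Data.Empty using (⊥-elim)
open import Data.Sum using (_⊎_; inj₁; inj₂)
open import Data.Product using (Σ; ∃; _×_; _,_; proj₁; proj₂; map; map₂)
open import Data.Sum.Function.Propositional using (_⊎-↔_)
open import Data.Product.Function.NonDependent.Propositional using (_×-↔_)
open import Function using (_∘_; id)
open import Function.Bundles using (_↔_; mk↔ₛ′; Inverse)
open import Function.Properties.Inverse using (↔-trans; ↔-sym; ↔-refl)
open import Relation.Binary.Definitions using (DecidableEquality)
open import Relation.Binary.PropositionalEquality
open import Relation.Nullary using (¬_; Dec; yes; no)
open import Relation.Nullary.Decidable using (False; toWitnessFalse; fromWitnessFalse; map′)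

IsFinite : Set → Set
IsFinite A = ∃ λ n → A ↔ Fin n

finite-↔ : {A B : Set} → A ↔ B → IsFinite B → IsFinite A
finite-↔ A↔B (n , B↔Fin) = n , ↔-trans A↔B B↔Fin

finite-⊤ : IsFinite ⊤
finite-⊤ = 1 , ↔-sym 1↔⊤

finite-Bool : IsFinite Bool
finite-Bool = 2 , ↔-sym 2↔Bool

finite-Fin : ∀ k → IsFinite (Fin k)
finite-Fin k = k , ↔-refl

finite-⊎ : {A B : Set} → IsFinite A → IsFinite B → IsFinite (A ⊎ B)
finite-⊎ (m , A↔) (n , B↔) = m + n , ↔-trans (A↔ ⊎-↔ B↔) (↔-sym +↔⊎)

finite-× : {A B : Set} → IsFinite A → IsFinite B → IsFinite (A × B)
finite-× (m , A↔) (n , B↔) = m * n , ↔-trans (A↔ ×-↔ B↔) (↔-sym *↔×)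

module _ {B : Set} (_≟_ : DecidableEquality B) where

  -- B with the element c removed.  Using the Boolean condition False keeps
  -- the membership proofs irrelevant, so no function extensionality is needed.
  Without : B → Set
  Without c = Σ B λ b → False (b ≟ c)

  without-≡ : ∀ {c} {x y : Without c} → proj₁ x ≡ proj₁ y → x ≡ y
  without-≡ {x = b , p} {y = .b , q} refl = cong (b ,_) (T-irrelevant p q)

  without-≟ : ∀ c → DecidableEquality (Without c)
  without-≟ c x y = map′ without-≡ (cong proj₁) (proj₁ x ≟ proj₁ y)

  split-off : ∀ c → B ↔ (⊤ ⊎ Without c)
  split-off c = mk↔ₛ′ to from to∘from from∘to
    where
    classify : (b : B) → Dec (b ≡ c) → ⊤ ⊎ Without c
    classify b (yes _)    = inj₁ tt
    classify b (no b≢c)   = inj₂ (b , fromWitnessFalse b≢c)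

    to : B → ⊤ ⊎ Without c
    to b = classify b (b ≟ c)

    from : ⊤ ⊎ Without c → B
    from (inj₁ tt)      = c
    from (inj₂ (b , _)) = b

    classify-≢ : ∀ b d (b≢c : False (b ≟ c)) → classify b d ≡ inj₂ (b , b≢c)
    classify-≢ b (yes b≡c) b≢c = ⊥-elim (toWitnessFalse b≢c b≡c)
    classify-≢ b (no _)    b≢c = cong inj₂ (without-≡ refl)

    from∘classify : ∀ b d → from (classify b d) ≡ b
    from∘classify b (yes b≡c) = sym b≡c
    from∘classify b (no _)    = refl

    from∘to : ∀ b → from (to b) ≡ b
    from∘to b = from∘classify b (b ≟ c)

    to∘from : ∀ y → to (from y) ≡ y
    to∘from (inj₁ tt) with c ≟ c
    ... | yes _   = refl
    ... | no c≢c  = ⊥-elim (c≢c refl)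
    to∘from (inj₂ (b , b≢c)) = classify-≢ b (b ≟ c) b≢c

-- Induction on m: either s 0 recurs among s 1, …, s m and can be dropped, or
-- B splits as {s 0} ⊎ (B ∖ {s 0}) and the rest of s enumerates B ∖ {s 0}.
image-of-Fin-finite : ∀ m {B : Set} → DecidableEquality B →
                      (s : Fin m → B) → (∀ b → ∃ λ i → s i ≡ b) → IsFinite B
image-of-Fin-finite zero _ s onto =
  0 , mk↔ₛ′ (λ b → ⊥-elim (¬Fin0 (proj₁ (onto b)))) (λ ()) (λ ())
            (λ b → ⊥-elim (¬Fin0 (proj₁ (onto b))))
image-of-Fin-finite (suc m) {B} _≟_ s onto with any? (λ i → s (suc i) ≟ s zero)
... | yes (i , repeated) = image-of-Fin-finite m _≟_ (s ∘ suc) onto-rest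
  where
  onto-rest : ∀ b → ∃ λ i → s (suc i) ≡ b
  onto-rest b with onto b
  ... | zero  , s0≡b = i , trans repeated s0≡b
  ... | suc j , sj≡b = j , sj≡b
... | no fresh =
  finite-↔ (split-off _≟_ c)
    (finite-⊎ finite-⊤ (image-of-Fin-finite m (without-≟ _≟_ c) rest onto-rest))
  where
  c : B
  c = s zero

  rest : Fin m → Without _≟_ c
  rest i = s (suc i) , fromWitnessFalse (λ e → fresh (i , e))

  onto-rest : ∀ x → ∃ λ i → rest i ≡ x
  onto-rest (b , b≢c) with onto b
  ... | zero  , c≡b  = ⊥-elim (toWitnessFalse b≢c (sym c≡b))
  ... | suc j , sj≡b = j , without-≡ _≟_ sj≡b

surjective-image-finite : {A B : Set} → IsFinite A → DecidableEquality B →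
                          (s : A → B) → (∀ b → ∃ λ a → s a ≡ b) → IsFinite B
surjective-image-finite (m , A↔Fin) _≟_ s onto =
  image-of-Fin-finite m _≟_ (s ∘ Inverse.from A↔Fin) onto-Fin
  where
  onto-Fin : ∀ b → ∃ λ i → s (Inverse.from A↔Fin i) ≡ b
  onto-Fin b with onto b
  ... | a , sa≡b = Inverse.to A↔Fin a , trans (cong s (Inverse.strictlyInverseʳ A↔Fin a)) sa≡b

opposite-swap : ∀ {k} {i j : Fin k} → j ≡ opposite i → i ≡ opposite j
opposite-swap {i = i} j≡i′ = trans (sym (opposite-involutive i)) (cong opposite (sym j≡i′))

-- For even k the involution has no fixed point: a fixed point j would give
-- k = j + (j + 1), an odd number.
opposite-no-fixpoint : ∀ {k} → 2 ∣ k → (j : Fin k) → opposite j ≢ j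
opposite-no-fixpoint {k} (divides q k≡q*2) j fixed = even≢odd q t (begin
  2 * q               ≡⟨ *-comm 2 q ⟩
  q * 2               ≡⟨ sym k≡q*2 ⟩
  k                   ≡⟨ sym (m∸n+n≡m (toℕ<n j)) ⟩
  (k ∸ suc t) + suc t ≡⟨ cong (_+ suc t) k∸[1+t]≡t ⟩
  t + suc t           ≡⟨ +-suc t t ⟩
  suc (t + t)         ≡⟨ cong (λ x → suc (t + x)) (sym (+-identityʳ t)) ⟩
  suc (2 * t)         ∎)
  where
  open ≡-Reasoning
  t : ℕ
  t = toℕ j
  k∸[1+t]≡t : k ∸ suc t ≡ t
  k∸[1+t]≡t = trans (sym (opposite-prop j)) (cong toℕ fixed)

module SherkFacts (G : Geometry) (ax : IsPartialSherkPlane G) where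
  open Geometry G
  open IsPartialSherkPlane ax

  -- If w ⟂ w, then w is the only
  -- perpendicular to w and every point lies on w; hence w is perpendicular
  -- to every line missing some point.  For the lines x ⟂ y, z of (B5) with
  -- meeting point P of x and y, P misses z, so z ⟂ w, z = w and P lies on z.
  ⟂-irreflexive : ∀ w → ¬ (w ⟂ w)
  ⟂-irreflexive w w⟂w with B5
  ... | x , y , z , x⟂y , _ , _ , no-common with B2 x y x⟂y
  ... | P , Px , Py = no-common (P , Px , Py , subst (P I_) (sym z≡w) (all-on-w P))
    where
    perp-at-is-w : ∀ S n → S I w → S I n → n ⟂ w → n ≡ w
    perp-at-is-w S n Sw Sn n⟂w with B4 w S Sw
    ... | _ , _ , unique = trans (unique n Sn n⟂w) (sym (unique w Sw w⟂w))

    all-on-w : ∀ R → R I w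
    all-on-w R with B3 R w
    ... | m , Rm , m⟂w with B2 m w m⟂w
    ... | S , Sm , Sw = subst (R I_) (perp-at-is-w S m Sw Sm m⟂w) Rm

    only-perp : ∀ n → w ⟂ n → n ≡ w
    only-perp n w⟂n with B2 w n w⟂n
    ... | S , Sw , Sn = perp-at-is-w S n Sw Sn (B1 w n w⟂n)

    -- The perpendicular m to n through a point R off n meets n in S ≠ R;
    -- both S and R lie on m and on w, so m = w.
    perp-if-missed : ∀ n R → ¬ (R I n) → w ⟂ n
    perp-if-missed n R R∉n with B3 R n
    ... | m , Rm , m⟂n with B2 m n m⟂n
    ... | S , Sm , Sn =
      subst (_⟂ n) (A* S R m w (λ S≡R → R∉n (subst (_I n) S≡R Sn)) Sm Rm (all-on-w S) (all-on-w R)) m⟂n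

    z≡w : z ≡ w
    z≡w = only-perp z (perp-if-missed z P λ Pz → no-common (P , Px , Py , Pz))

  some-line : Line
  some-line = proj₁ B5

  line-through : ∀ P → Σ Line (P I_)
  line-through P = map₂ proj₁ (B3 P some-line)

  base-point : Point
  base-point with B5
  ... | x , y , _ , x⟂y , _ = proj₁ (B2 x y x⟂y)

  point-on : ∀ ℓ → Σ Point (_I ℓ)
  point-on ℓ with B3 base-point ℓ
  ... | m , _ , m⟂ℓ = map₂ proj₂ (B2 m ℓ m⟂ℓ)

  -- Two distinct points: the meeting point of x ⟂ y from (B5) does not lie
  -- on z, so it differs from any point of z.
  two-points : Σ Point λ P → Σ Point λ R → P ≢ R
  two-points with B5
  ... | x , y , z , x⟂y , _ , _ , no-common with B2 x y x⟂y | point-on z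
  ... | P , Px , Py | R , Rz = P , R , λ P≡R → no-common (P , Px , Py , subst (_I z) (sym P≡R) Rz)

-- A finite partial Sherk plane has finitely many lines (classically)

module FiniteLines (G : Geometry) (ax : IsPartialSherkPlane G) (em : ExcludedMiddle 0ℓ) where
  open Geometry G
  open IsPartialSherkPlane ax
  open SherkFacts G ax

  another-point : ∀ P → Σ Point (P ≢_)
  another-point P with two-points
  ... | P₀ , R₀ , P₀≢R₀ with em {P ≡ P₀}
  ... | yes refl  = R₀ , P₀≢R₀
  ... | no P≢P₀   = P₀ , P≢P₀

  Joining : Point → Point → Set
  Joining P Q = Σ Line λ ℓ → P ≢ Q × P I ℓ × Q I ℓ

  -- The line coded by (P, Q, b): the line PQ if b is false, the perpendicular
  -- to PQ at P if b is true, and an arbitrary line if P, Q are not joined.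
  decode : ∀ P Q → Bool → Dec (Joining P Q) → Line
  decode P Q false (yes (ℓ , _))            = ℓ
  decode P Q true  (yes (ℓ , _ , Pℓ , _))   = proj₁ (B4 ℓ P Pℓ)
  decode P Q _     (no _)                   = some-line

  line-of : Point × Point × Bool → Line
  line-of (P , Q , b) = decode P Q b em

  joining-line-coded : ∀ {P Q ℓ} → P ≢ Q → P I ℓ → Q I ℓ → line-of (P , Q , false) ≡ ℓ
  joining-line-coded {P} {Q} {ℓ} P≢Q Pℓ Qℓ = decodes em
    where
    decodes : ∀ d → decode P Q false d ≡ ℓ
    decodes (yes (ℓ′ , _ , Pℓ′ , Qℓ′)) = A* P Q ℓ′ ℓ P≢Q Pℓ′ Qℓ′ Pℓ Qℓ
    decodes (no none)                  = ⊥-elim (none (ℓ , P≢Q , Pℓ , Qℓ))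

  -- A line whose only point is P is coded by (P, R, true) for any R ≢ P: the
  -- perpendicular m to ℓ through R meets ℓ, necessarily in P, so m is the
  -- line PR and ℓ is the unique perpendicular to it at P.
  lonely-line-coded : ∀ {P R ℓ} → P ≢ R → P I ℓ → (∀ S → S I ℓ → S ≡ P) →
                      line-of (P , R , true) ≡ ℓ
  lonely-line-coded {P} {R} {ℓ} P≢R Pℓ only-P with B3 R ℓ
  ... | m , Rm , m⟂ℓ = decodes em
    where
    Pm : P I m
    Pm with B2 m ℓ m⟂ℓ
    ... | S , Sm , Sℓ = subst (_I m) (only-P S Sℓ) Sm

    decodes : ∀ d → decode P R true d ≡ ℓ
    decodes (yes (ℓ′ , _ , Pℓ′ , Rℓ′)) with B4 ℓ′ P Pℓ′
    ... | _ , _ , unique =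
      sym (unique ℓ Pℓ (subst (ℓ ⟂_) (A* P R m ℓ′ P≢R Pm Rm Pℓ′ Rℓ′) (B1 m ℓ m⟂ℓ)))
    decodes (no none) = ⊥-elim (none (m , P≢R , Pm , Rm))

  line-of-onto : ∀ ℓ → ∃ λ t → line-of t ≡ ℓ
  line-of-onto ℓ with point-on ℓ
  ... | P , Pℓ with em {Σ Point λ Q → P ≢ Q × Q I ℓ}
  ... | yes (Q , P≢Q , Qℓ) = (P , Q , false) , joining-line-coded P≢Q Pℓ Qℓ
  ... | no lonely with another-point P
  ...   | R , P≢R = (P , R , true) , lonely-line-coded P≢R Pℓ only-P
    where
    only-P : ∀ S → S I ℓ → S ≡ P
    only-P S Sℓ with em {S ≡ P}
    ... | yes S≡P = S≡P
    ... | no S≢P  = ⊥-elim (lonely (S , S≢P ∘ sym , Sℓ))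

  lines-finite : Finite G → IsFinite Line
  lines-finite points-finite =
    surjective-image-finite (finite-× points-finite (finite-× points-finite finite-Bool))
                            (λ _ _ → em) line-of line-of-onto

pattern old x     = inj₁ x
pattern new ℓ i   = inj₂ (ℓ , i)
pattern g i       = inj₂ i

module Extension (G : Geometry) (ax : IsPartialSherkPlane G) (k : ℕ) where
  open Geometry G
  open IsPartialSherkPlane ax
  open SherkFacts G ax
  open Geometry (Gk G k) using () renaming (Point to Point⁺; Line to Line⁺; _I_ to _I⁺_; _⟂_ to _⟂⁺_)

  -- A new point P_{a,i} lies
  -- only on a and g_i, so two lines through it that are both old (or both
  -- new) coincide, and two new points sharing an old and a new line are equal.
  Gk-A* : ∀ (P R : Point⁺) (ℓ m : Line⁺) → P ≢ R →
          P I⁺ ℓ → R I⁺ ℓ → P I⁺ m → R I⁺ m → ℓ ≡ m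
  Gk-A* (old P) (old R) (old ℓ) (old m) P≢R Pℓ Rℓ Pm Rm =
    cong old (A* P R ℓ m (P≢R ∘ cong old) Pℓ Rℓ Pm Rm)
  Gk-A* (old P)   (new a i) (old ℓ) (old m) _ _ refl _ refl = refl
  Gk-A* (new a i) R         (old ℓ) (old m) _ refl _ refl _ = refl
  Gk-A* (new a i) R         (g j)   (g j′)  _ refl _ refl _ = refl
  Gk-A* (new a i) (new b j) (old ℓ) (g j′)  P≢R refl refl refl refl = ⊥-elim (P≢R refl)
  Gk-A* (new a i) (new b j) (g j′)  (old ℓ) P≢R refl refl refl refl = ⊥-elim (P≢R refl)

  Gk-B1 : ∀ ℓ m → ℓ ⟂⁺ m → m ⟂⁺ ℓ
  Gk-B1 (old ℓ) (old m) = B1 ℓ m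
  Gk-B1 (old ℓ) (g j)   _ = tt
  Gk-B1 (g i)   (old m) _ = tt

  Gk-B2 : ∀ ℓ m → ℓ ⟂⁺ m → Σ Point⁺ λ P → P I⁺ ℓ × P I⁺ m
  Gk-B2 (old ℓ) (old m) ℓ⟂m = map old id (B2 ℓ m ℓ⟂m)
  Gk-B2 (old ℓ) (g j)   _   = new ℓ j , refl , refl
  Gk-B2 (g j)   (old m) _   = new m j , refl , refl

  Gk-B3 : ∀ P ℓ → Σ Line⁺ λ m → P I⁺ m × m ⟂⁺ ℓ
  Gk-B3 (old P)   (old ℓ) = map old id (B3 P ℓ)
  Gk-B3 (old P)   (g j)   = map old (_, tt) (line-through P)
  Gk-B3 (new a i) (old ℓ) = g i , refl , tt
  Gk-B3 (new a i) (g j)   = old a , refl , tt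

  -- At P_{ℓ,i} the perpendicular to ℓ is g_i: the only other line through
  -- P_{ℓ,i} is ℓ itself, which is not perpendicular to ℓ.
  Gk-B4 : ∀ ℓ P → P I⁺ ℓ →
          Σ Line⁺ λ m → (P I⁺ m × m ⟂⁺ ℓ) × (∀ m′ → P I⁺ m′ → m′ ⟂⁺ ℓ → m′ ≡ m)
  Gk-B4 (old ℓ) (old P) Pℓ with B4 ℓ P Pℓ
  ... | m , Pm⟂ℓ , unique = old m , Pm⟂ℓ , λ { (old m′) Pm′ m′⟂ℓ → cong old (unique m′ Pm′ m′⟂ℓ) }
  Gk-B4 (old ℓ) (new .ℓ i) refl = g i , (refl , tt) , λ
    { (old .ℓ) refl ℓ⟂ℓ → ⊥-elim (⟂-irreflexive ℓ ℓ⟂ℓ)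
    ; (g j)    refl _   → refl }
  Gk-B4 (g j) (new a .j) refl = old a , (refl , tt) , λ { (old .a) refl _ → refl }

  -- Old lines without a common old point have no common point in 𝒢_k when
  -- two of them are perpendicular: a new point lies on only one old line.
  Gk-no-common-point : ∀ {x y z} → x ⟂ y → ¬ (Σ Point λ P → P I x × P I y × P I z) →
                       ¬ (Σ Point⁺ λ P → P I⁺ old x × P I⁺ old y × P I⁺ old z)
  Gk-no-common-point x⟂y no-common (old P , Px , Py , Pz) = no-common (P , Px , Py , Pz)
  Gk-no-common-point x⟂y no-common (new a i , refl , refl , refl) = ⟂-irreflexive a x⟂y

  Gk-B5 : Σ Line⁺ λ x → Σ Line⁺ λ y → Σ Line⁺ λ z →
          x ⟂⁺ y × ¬ (x ⟂⁺ z) × ¬ (y ⟂⁺ z) × ¬ (Σ Point⁺ λ P → P I⁺ x × P I⁺ y × P I⁺ z)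
  Gk-B5 with B5
  ... | x , y , z , x⟂y , x⟂̸z , y⟂̸z , no-common =
    old x , old y , old z , x⟂y , x⟂̸z , y⟂̸z , Gk-no-common-point x⟂y no-common

  Gk-sherk : IsPartialSherkPlane (Gk G k)
  Gk-sherk = record { A* = Gk-A* ; B1 = Gk-B1 ; B2 = Gk-B2 ; B3 = Gk-B3 ; B4 = Gk-B4 ; B5 = Gk-B5 }

pattern Q = inj₂ tt

-- The index g₀ (available as k ≥ 1) names a line g₀ through Q, which is
-- perpendicular to every old line.
module StarExtension (G : Geometry) (ax : IsPartialSherkPlane G)
                     (k : ℕ) (k-even : 2 ∣ k) (g₀ : Fin k) where
  open Geometry G
  open IsPartialSherkPlane ax
  open Extension G ax k
  open Geometry (Gk G k) using () renaming (Point to Point⁺; Line to Line⁺; _I_ to _I⁺_; _⟂_ to _⟂⁺_)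
  open Geometry (Gk* G k) using () renaming (Point to Point*; _I_ to _I*_; _⟂_ to _⟂*_)

  ⟂⁺⇒⟂* : ∀ ℓ m → ℓ ⟂⁺ m → ℓ ⟂* m
  ⟂⁺⇒⟂* (old ℓ) m       ℓ⟂m = ℓ⟂m
  ⟂⁺⇒⟂* (g i)   (old m) g⟂m = g⟂m

  -- Q lies only on new lines, and a point sharing two new lines with Q lies
  -- on a single new line.
  Gk*-A* : ∀ (P R : Point*) (ℓ m : Line⁺) → P ≢ R →
           P I* ℓ → R I* ℓ → P I* m → R I* m → ℓ ≡ m
  Gk*-A* (old P)         (old R)         ℓ m P≢R = Gk-A* P R ℓ m (P≢R ∘ cong old)
  Gk*-A* (old (new a i)) Q               (g j) (g j′) _ refl _ refl _ = refl
  Gk*-A* Q               (old (new a i)) (g j) (g j′) _ _ refl _ refl = refl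
  Gk*-A* Q               Q               ℓ m P≢R = ⊥-elim (P≢R refl)

  Gk*-B1 : ∀ ℓ m → ℓ ⟂* m → m ⟂* ℓ
  Gk*-B1 (old ℓ) (old m) = B1 ℓ m
  Gk*-B1 (old ℓ) (g j)   _ = tt
  Gk*-B1 (g i)   (old m) _ = tt
  Gk*-B1 (g i)   (g j)   = opposite-swap

  Gk*-B2 : ∀ ℓ m → ℓ ⟂* m → Σ Point* λ P → P I* ℓ × P I* m
  Gk*-B2 (old ℓ) m       ℓ⟂m = map old id (Gk-B2 (old ℓ) m ℓ⟂m)
  Gk*-B2 (g i)   (old m) g⟂m = map old id (Gk-B2 (g i) (old m) g⟂m)
  Gk*-B2 (g i)   (g j)   _   = Q , tt , tt

  Gk*-B3 : ∀ P ℓ → Σ Line⁺ λ m → P I* m × m ⟂* ℓ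
  Gk*-B3 (old P) ℓ with Gk-B3 P ℓ
  ... | m , Pm , m⟂ℓ     = m , Pm , ⟂⁺⇒⟂* m ℓ m⟂ℓ
  Gk*-B3 Q       (old ℓ) = g g₀ , tt , tt
  Gk*-B3 Q       (g j)   = g (opposite j) , tt , sym (opposite-involutive j)

  -- Through Q the perpendicular to g_j is g_{k-j+1}.  At P_{a,j} the
  -- perpendicular to g_j is a: the other line g_j through it is not
  -- perpendicular to g_j because k is even.
  Gk*-B4 : ∀ ℓ P → P I* ℓ →
           Σ Line⁺ λ m → (P I* m × m ⟂* ℓ) × (∀ m′ → P I* m′ → m′ ⟂* ℓ → m′ ≡ m)
  Gk*-B4 (old ℓ) (old P) Pℓ with Gk-B4 (old ℓ) P Pℓ
  ... | m , (Pm , m⟂ℓ) , unique = m , (Pm , ⟂⁺⇒⟂* m (old ℓ) m⟂ℓ) , λ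
    { (old m′) → unique (old m′)
    ; (g j)    → unique (g j) }
  Gk*-B4 (g j) (old (new a .j)) refl = old a , (refl , tt) , λ
    { (old .a) refl _   → refl
    ; (g .j)   refl j≡j′ → ⊥-elim (opposite-no-fixpoint k-even j (sym j≡j′)) }
  Gk*-B4 (g j) Q tt = g (opposite j) , (tt , sym (opposite-involutive j)) , λ
    { (g j′) tt j≡j′′ → cong g (opposite-swap j≡j′′) }

  Gk*-B5 : Σ Line⁺ λ x → Σ Line⁺ λ y → Σ Line⁺ λ z →
           x ⟂* y × ¬ (x ⟂* z) × ¬ (y ⟂* z) × ¬ (Σ Point* λ P → P I* x × P I* y × P I* z)
  Gk*-B5 with B5
  ... | x , y , z , x⟂y , x⟂̸z , y⟂̸z , no-common =
    old x , old y , old z , x⟂y , x⟂̸z , y⟂̸z ,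
    λ { (old P , Px , Py , Pz) → Gk-no-common-point x⟂y no-common (P , Px , Py , Pz) }

  Gk*-sherk : IsPartialSherkPlane (Gk* G k)
  Gk*-sherk = record
    { A* = Gk*-A* ; B1 = Gk*-B1 ; B2 = Gk*-B2 ; B3 = Gk*-B3 ; B4 = Gk*-B4 ; B5 = Gk*-B5 }

Gk-finite : ∀ G → IsPartialSherkPlane G → ExcludedMiddle 0ℓ → Finite G → ∀ k → Finite (Gk G k)
Gk-finite G ax em points-finite k =
  finite-⊎ points-finite (finite-× (FiniteLines.lines-finite G ax em points-finite) (finite-Fin k))

Gk*-finite : ∀ G → IsPartialSherkPlane G → ExcludedMiddle 0ℓ → Finite G → ∀ k → Finite (Gk* G k)
Gk*-finite G ax em points-finite k = finite-⊎ (Gk-finite G ax em points-finite k) finite-⊤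

lemma4p1 : (G : Geometry) → IsPartialSherkPlane G →
           (k : ℕ) → 1 ≤ k →
           (IsPartialSherkPlane (Gk G k) × (ExcludedMiddle 0ℓ → Finite G → Finite (Gk G k)))
           × (2 ∣ k →
              IsPartialSherkPlane (Gk* G k) × (ExcludedMiddle 0ℓ → Finite G → Finite (Gk* G k)))
lemma4p1 G ax k 1≤k =
  (Extension.Gk-sherk G ax k , λ em points-finite → Gk-finite G ax em points-finite k) ,
  λ k-even → StarExtension.Gk*-sherk G ax k k-even (fromℕ< 1≤k) ,
             λ em points-finite → Gk*-finite G ax em points-finite k
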